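{- Let $\Gamma$ be a finite, simple, connected graph and $G\le\mathrm{Aut}(\Gamma)$ such that $\Gamma$ is $(G,s)$-geodesic transitive with $s\ge 2$. If $\Gamma$ has girth at least $2s$, then $\Gamma$ is $(G,s)$-arc transitive.
   Context: An $s$-arc is a sequence $(u_0,\dots,u_s)$ of vertices with consecutive vertices adjacent and $u_{j-1}\neq u_{j+1}$; it is an $s$-geodesic if $d_\Gamma(u_0,u_s)=s$. $\Gamma$ is $(G,s)$-geodesic transitive if $s\le\mathrm{diam}(\Gamma)$ and for each $1\le i\le s$, $\Gamma$ has an $i$-geodesic and $G$ is transitive on $i$-geodesics. $\Gamma$ is $(G,s)$-arc transitive if it has an $s$-arc and $G$ is transitive on the set of $s$-arcs. -}

module Defs where

open import Data.Nat using (ℕ; zero; suc; _+_; _*_; _≤_; _<_)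
open import Data.Fin using (Fin)
open import Data.Bool using (Bool; true; false)
open import Data.Product using (Σ; ∃; _×_; _,_)
open import Relation.Binary.PropositionalEquality using (_≡_; _≢_)
open import Data.Fin.Permutation using (Permutation′; _⟨$⟩ʳ_; id; _∘ₚ_; flip)

record Graph : Set where
  field
    n       : ℕ
    adj     : Fin n → Fin n → Bool
    symm    : ∀ u v → adj u v ≡ adj v u
    irrefl  : ∀ u → adj u u ≡ false

module _ (Γ : Graph) where
  open Graph Γ

  Vertex : Set
  Vertex = Fin n

  Adj : Vertex → Vertex → Set
  Adj u v = adj u v ≡ true

  Walk : ℕ → Vertex → Vertex → Set
  Walk k u v = Σ (ℕ → Vertex) λ f →
    (f 0 ≡ u) × (f k ≡ v) × (∀ i → i < k → Adj (f i) (f (suc i)))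

  Dist : Vertex → Vertex → ℕ → Set
  Dist u v d = Walk d u v × (∀ k → Walk k u v → d ≤ k)

  Connected : Set
  Connected = ∀ u v → ∃ λ k → Walk k u v

  LeDiam : ℕ → Set
  LeDiam s = ∃ λ u → ∃ λ v → ∃ λ d → Dist u v d × (s ≤ d)

  -- s-arc (u_0,...,u_s), given by f i = u_i for i ≤ s (values beyond s irrelevant)
  IsArc : ℕ → (ℕ → Vertex) → Set
  IsArc s f = (∀ i → i < s → Adj (f i) (f (suc i)))
            × (∀ i → suc i < s → f i ≢ f (suc (suc i)))

  IsGeodesic : ℕ → (ℕ → Vertex) → Set
  IsGeodesic s f = IsArc s f × Dist (f 0) (f s) s

  IsCycle : ℕ → (ℕ → Vertex) → Set
  IsCycle k f = (3 ≤ k) × (∀ i → i < k → Adj (f i) (f (suc i))) × (f k ≡ f 0)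
              × (∀ i j → i < k → j < k → f i ≡ f j → i ≡ j)

  -- girth(Γ) ≥ g  (vacuous if Γ is acyclic, girth = ∞)
  GirthAtLeast : ℕ → Set
  GirthAtLeast g = ∀ k f → IsCycle k f → g ≤ k

  IsAutomorphism : Permutation′ n → Set
  IsAutomorphism σ = ∀ u v → adj (σ ⟨$⟩ʳ u) (σ ⟨$⟩ʳ v) ≡ adj u v

  record IsAutSubgroup (G : Permutation′ n → Set) : Set where
    field
      auto   : ∀ σ → G σ → IsAutomorphism σ
      hasId  : G id
      closed : ∀ σ τ → G σ → G τ → G (σ ∘ₚ τ)
      inv    : ∀ σ → G σ → G (flip σ)

  TransitiveOn : (Permutation′ n → Set) → ℕ → ((ℕ → Vertex) → Set) → Set
  TransitiveOn G s P = ∀ f h → P f → P h →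
    ∃ λ σ → G σ × (∀ i → i ≤ s → σ ⟨$⟩ʳ f i ≡ h i)

  GeodesicTransitive : (Permutation′ n → Set) → ℕ → Set
  GeodesicTransitive G s = LeDiam s ×
    (∀ i → 1 ≤ i → i ≤ s → (∃ λ f → IsGeodesic i f) × TransitiveOn G i (IsGeodesic i))

  ArcTransitive : (Permutation′ n → Set) → ℕ → Set
  ArcTransitive G s = (∃ λ f → IsArc s f) × TransitiveOn G s (IsArc s)

{-# OPTIONS --safe #-}
module Submission where

-- With girth at least 2s every s-arc f is an s-geodesic, so transitivity on
-- s-geodesics is already transitivity on s-arcs. By induction on j ≤ s, no arc from
-- f 0 to f j is shorter than j: if its penultimate vertex is f (j - 1), drop its last
-- step; otherwise f 0, ..., f j followed by the arc backwards is a closed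
-- non-backtracking walk, hence contains a cycle, so its length is at least 2s, which
-- forces the arc to have length at least s ≥ j. Arbitrary walks shorten to arcs by
-- cancelling backtracks.

open import Defs
open import Data.Nat using (ℕ; zero; suc; _+_; _∸_; _*_; _≤_; _<_; z≤n; s≤s; z<s; _<?_; s≤s⁻¹)
open import Data.Nat.Properties hiding (_≟_)
open import Data.Nat.Induction using (<-wellFounded)
open import Data.Fin using (_≟_)
open import Data.Product using (∃; _×_; _,_; proj₁)
open import Data.Sum using (_⊎_; inj₁; inj₂)
open import Induction.WellFounded using (Acc; acc)
open import Relation.Binary using (tri<; tri≈; tri>)
open import Relation.Nullary using (yes; no; contradiction)
open import Relation.Nullary.Decidable using (_×-dec_)
open import Relation.Binary.PropositionalEquality
open import Data.Fin.Permutation using (Permutation′)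

2*m≤n+o⇒o≤m⇒m≤n : ∀ {m n o} → 2 * m ≤ n + o → o ≤ m → m ≤ n
2*m≤n+o⇒o≤m⇒m≤n {m} {n} {o} 2m≤n+o o≤m = +-cancelʳ-≤ m m n (begin
  m + m       ≡⟨ cong (m +_) (sym (+-identityʳ m)) ⟩
  2 * m       ≤⟨ 2m≤n+o ⟩
  n + o       ≤⟨ +-monoʳ-≤ n o≤m ⟩
  n + m       ∎)
  where open ≤-Reasoning

data Cut (a : ℕ) : ℕ → Set where
  before : ∀ {t} → t < a → Cut a t
  from   : ∀ r → Cut a (r + a)

cut : ∀ a t → Cut a t
cut a t with t <? a
... | yes t<a = before t<a
... | no  t≮a = subst (Cut a) (m∸n+n≡m (≮⇒≥ t≮a)) (from (t ∸ a))

module _ {A : Set} where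

  shift : ℕ → (ℕ → A) → ℕ → A
  shift i w t = w (t + i)

  reverse : ℕ → (ℕ → A) → ℕ → A
  reverse a w t = w (a ∸ t)

  join : ℕ → (ℕ → A) → (ℕ → A) → ℕ → A
  join a g h t with t <? a
  ... | yes _ = g t
  ... | no  _ = h (t ∸ a)

module JoinProperties {A : Set} (a : ℕ) (g h : ℕ → A) where

  join-< : ∀ {t} → t < a → join a g h t ≡ g t
  join-< {t} t<a with t <? a
  ... | yes _   = refl
  ... | no  t≮a = contradiction t<a t≮a

  join-from : ∀ r → join a g h (r + a) ≡ h r
  join-from r with r + a <? a
  ... | yes r+a<a = contradiction r+a<a (≤⇒≯ (m≤n+m a r))
  ... | no  _     = cong h (m+n∸n≡m r a)

  join-≤ : ∀ {t} → g a ≡ h 0 → t ≤ a → join a g h t ≡ g t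
  join-≤ ga≡h0 t≤a with m≤n⇒m<n∨m≡n t≤a
  ... | inj₁ t<a  = join-< t<a
  ... | inj₂ refl = trans (join-from 0) (sym ga≡h0)

module _ (Γ : Graph) where
  open Graph Γ using (symm; irrefl)

  IsWalk : ℕ → (ℕ → Vertex Γ) → Set
  IsWalk k w = ∀ i → i < k → Adj Γ (w i) (w (suc i))

  NonBacktracking : ℕ → (ℕ → Vertex Γ) → Set
  NonBacktracking k w = ∀ i → suc i < k → w i ≢ w (suc (suc i))

  Arc : ℕ → Vertex Γ → Vertex Γ → Set
  Arc k u v = ∃ λ w → w 0 ≡ u × w k ≡ v × IsArc Γ k w

  Distinct : ℕ → (ℕ → Vertex Γ) → Set
  Distinct k w = ∀ i j → i < k → j < k → w i ≡ w j → i ≡ j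

  adj-sym : ∀ {u v} → Adj Γ u v → Adj Γ v u
  adj-sym {u} {v} uv = trans (symm v u) uv

  IsWalk-prefix : ∀ {m k w} → m ≤ k → IsWalk k w → IsWalk m w
  IsWalk-prefix m≤k walk i i<m = walk i (<-≤-trans i<m m≤k)

  IsArc-prefix : ∀ {m k w} → m ≤ k → IsArc Γ k w → IsArc Γ m w
  IsArc-prefix m≤k (walk , nb) = IsWalk-prefix m≤k walk , λ i i+1<m → nb i (<-≤-trans i+1<m m≤k)

  IsWalk-shift : ∀ {i m k w} → m + i ≤ k → IsWalk k w → IsWalk m (shift i w)
  IsWalk-shift {i} m+i≤k walk t t<m = walk (t + i) (<-≤-trans (+-monoˡ-< i t<m) m+i≤k)

  IsArc-shift : ∀ {i m k w} → m + i ≤ k → IsArc Γ k w → IsArc Γ m (shift i w)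
  IsArc-shift {i} m+i≤k (walk , nb) =
    IsWalk-shift m+i≤k walk , λ t t+1<m → nb (t + i) (<-≤-trans (+-monoˡ-< i t+1<m) m+i≤k)

  IsArc-reverse : ∀ {a w} → IsArc Γ a w → IsArc Γ a (reverse a w)
  IsArc-reverse {a} {w} (walk , nb) = walk-rev , nb-rev
    where
    walk-rev : IsWalk a (reverse a w)
    walk-rev t t<a = subst (λ x → Adj Γ (w x) (w (a ∸ suc t))) (sym (+-∸-assoc 1 t<a))
                       (adj-sym (walk (a ∸ suc t) (∸-monoʳ-< z<s t<a)))

    nb-rev : NonBacktracking a (reverse a w)
    nb-rev t t+1<a wa-t≡wa-t-2 = nb m m+1<a (sym (subst (λ x → w x ≡ w m) a∸t≡m+2 wa-t≡wa-t-2))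
      where
      m : ℕ
      m = a ∸ suc (suc t)
      a∸t≡m+2 : a ∸ t ≡ suc (suc m)
      a∸t≡m+2 = trans (+-∸-assoc 1 (<-trans (n<1+n t) t+1<a)) (cong suc (+-∸-assoc 1 t+1<a))
      m+1<a : suc m < a
      m+1<a = subst (_≤ a) a∸t≡m+2 (m∸n≤m a t)

  IsWalk-join : ∀ {a b g h} → g a ≡ h 0 → IsWalk a g → IsWalk b h → IsWalk (b + a) (join a g h)
  IsWalk-join {a} {b} {g} {h} ga≡h0 walk-g walk-h = walk
    where
    open JoinProperties a g h

    walk : IsWalk (b + a) (join a g h)
    walk t t<b+a with cut a t
    ... | before t<a = subst₂ (Adj Γ) (sym (join-< t<a)) (sym (join-≤ ga≡h0 t<a)) (walk-g t t<a)
    ... | from r     = subst₂ (Adj Γ) (sym (join-from r)) (sym (join-from (suc r)))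
                         (walk-h r (+-cancelʳ-< a r b t<b+a))

  IsArc-join : ∀ {a b g h} → g (suc a) ≡ h 0 → g a ≢ h 1 →
               IsArc Γ (suc a) g → IsArc Γ b h → IsArc Γ (b + suc a) (join (suc a) g h)
  IsArc-join {a} {b} {g} {h} junction turn (walk-g , nb-g) (walk-h , nb-h) =
    IsWalk-join junction walk-g walk-h , nb
    where
    open JoinProperties (suc a) g h

    nb : NonBacktracking (b + suc a) (join (suc a) g h)
    nb t t+1<b+a+1 with cut (suc a) t
    ... | from r = subst₂ _≢_ (sym (join-from r)) (sym (join-from (suc (suc r))))
                     (nb-h r (+-cancelʳ-< (suc a) (suc r) b t+1<b+a+1))
    ... | before t<a+1 with m≤n⇒m<n∨m≡n (s≤s⁻¹ t<a+1)
    ...   | inj₁ t<a  = subst₂ _≢_ (sym (join-< t<a+1)) (sym (join-≤ junction (s≤s t<a))) (nb-g t (s≤s t<a))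
    ...   | inj₂ refl = subst₂ _≢_ (sym (join-< t<a+1)) (sym (join-from 1)) turn

  repetition? : ∀ k w → Distinct k w ⊎ ∃ λ i → ∃ λ j → i < j × j < k × w i ≡ w j
  repetition? k w with anyUpTo? (λ j → anyUpTo? (λ i → w i ≟ w j) j) k
  ... | yes (j , j<k , i , i<j , wi≡wj) = inj₂ (i , j , i<j , j<k , wi≡wj)
  ... | no none = inj₁ distinct
    where
    distinct : Distinct k w
    distinct i j i<k j<k wi≡wj with <-cmp i j
    ... | tri< i<j _ _ = contradiction (j , j<k , i , i<j , wi≡wj) none
    ... | tri≈ _ i≡j _ = i≡j
    ... | tri> _ _ j<i = contradiction (i , i<k , j , j<i , sym wi≡wj) none

  closedDistinctArc⇒cycle : ∀ {k w} → 0 < k → IsArc Γ k w → w k ≡ w 0 → Distinct k w → IsCycle Γ k w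
  closedDistinctArc⇒cycle {1} {w} _ (walk , _) closed _ =
    contradiction (trans (sym (irrefl (w 0))) (subst (Adj Γ (w 0)) closed (walk 0 z<s))) λ ()
  closedDistinctArc⇒cycle {2} _ (_ , nb) closed _ = contradiction (sym closed) (nb 0 ≤-refl)
  closedDistinctArc⇒cycle {suc (suc (suc _))} _ (walk , _) closed distinct =
    s≤s (s≤s (s≤s z≤n)) , walk , closed , distinct

  girth≤closedArc : ∀ {g k w} → GirthAtLeast Γ g → 0 < k → IsArc Γ k w → w k ≡ w 0 → g ≤ k
  girth≤closedArc {g} girth 0<k = go (<-wellFounded _) 0<k
    where
    go : ∀ {k w} → Acc _<_ k → 0 < k → IsArc Γ k w → w k ≡ w 0 → g ≤ k
    go {k} {w} (acc shorter) 0<k arc closed with repetition? k w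
    ... | inj₁ distinct = girth k w (closedDistinctArc⇒cycle 0<k arc closed distinct)
    ... | inj₂ (i , j , i<j , j<k , wi≡wj) =
      ≤-trans (go (shorter j∸i<k) (m<n⇒0<n∸m i<j) (IsArc-shift j∸i+i≤k arc)
                  (trans (cong w j∸i+i≡j) (sym wi≡wj)))
              (<⇒≤ j∸i<k)
      where
      j∸i+i≡j : j ∸ i + i ≡ j
      j∸i+i≡j = m∸n+n≡m (<⇒≤ i<j)
      j∸i+i≤k : j ∸ i + i ≤ k
      j∸i+i≤k = ≤-trans (≤-reflexive j∸i+i≡j) (<⇒≤ j<k)
      j∸i<k : j ∸ i < k
      j∸i<k = ≤-<-trans (m∸n≤m j i) j<k

  backtrack? : ∀ k w → NonBacktracking k w ⊎ ∃ λ i → suc i < k × w i ≡ w (suc (suc i))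
  backtrack? k w with anyUpTo? (λ i → (suc i <? k) ×-dec (w i ≟ w (suc (suc i)))) k
  ... | yes (i , _ , backtrack) = inj₂ (i , backtrack)
  ... | no none = inj₁ λ i i+1<k wi≡wi+2 → none (i , <-trans (n<1+n i) i+1<k , i+1<k , wi≡wi+2)

  cancelBacktrack : ∀ {k w i} → IsWalk k w → suc i < k → w i ≡ w (suc (suc i)) →
                    ∃ λ m → m < k × Walk Γ m (w 0) (w k)
  cancelBacktrack {k} {w} {i} walk i+1<k wi≡wi+2 with cut (suc (suc i)) k
  ... | before k<i+2 = contradiction i+1<k (<⇒≱ k<i+2)
  ... | from r = r + i , +-monoʳ-< r (m<n⇒m<1+n (n<1+n i)) ,
                 join i w h , join-≤ wi≡wi+2 z≤n , join-from r ,
                 IsWalk-join wi≡wi+2 (IsWalk-prefix (≤-trans (n≤1+n i) (<⇒≤ i+1<k)) walk) (IsWalk-shift ≤-refl walk)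
    where
    h : ℕ → Vertex Γ
    h = shift (suc (suc i)) w
    open JoinProperties i w h

  walk⇒arc : ∀ {k u v} → Walk Γ k u v → ∃ λ m → m ≤ k × Arc m u v
  walk⇒arc = go (<-wellFounded _)
    where
    go : ∀ {k u v} → Acc _<_ k → Walk Γ k u v → ∃ λ m → m ≤ k × Arc m u v
    go {k} (acc shorter) (w , w0 , wk , walk) with backtrack? k w
    ... | inj₁ nb = k , ≤-refl , w , w0 , wk , walk , nb
    ... | inj₂ (i , i+1<k , wi≡wi+2) with cancelBacktrack walk i+1<k wi≡wi+2
    ...   | m , m<k , shorterWalk with go (shorter m<k) shorterWalk
    ...     | l , l≤m , arc = l , ≤-trans l≤m (<⇒≤ m<k) , subst₂ (Arc l) w0 wk arc

  module _ {s} (girth : GirthAtLeast Γ (2 * s)) {f} (arc : IsArc Γ s f) where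

    noShortcut : ∀ {j k} → j ≤ s → Arc k (f 0) (f j) → j ≤ k
    noShortcut {zero} _ _ = z≤n
    noShortcut {suc j} {zero} j+1≤s (w , w0 , wj+1 , _) =
      ≤-trans j+1≤s (2*m≤n+o⇒o≤m⇒m≤n (girth≤closedArc girth z<s closedArc closed) j+1≤s)
      where
      closedArc : IsArc Γ (suc j) f
      closedArc = IsArc-prefix j+1≤s arc
      closed : f (suc j) ≡ f 0
      closed = trans (sym wj+1) w0
    noShortcut {suc j} {suc k} j+1≤s (w , w0 , wk+1 , arc-w) with w k ≟ f j
    ... | yes wk≡fj = s≤s (noShortcut (<⇒≤ j+1≤s) (w , w0 , wk≡fj , IsArc-prefix (n≤1+n k) arc-w))
    ... | no  wk≢fj = ≤-trans j+1≤s (2*m≤n+o⇒o≤m⇒m≤n (girth≤closedArc girth z<s closedArc closed) j+1≤s)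
      where
      h : ℕ → Vertex Γ
      h = reverse (suc k) w
      open JoinProperties (suc j) f h
      closedArc : IsArc Γ (suc k + suc j) (join (suc j) f h)
      closedArc = IsArc-join (sym wk+1) (λ fj≡wk → wk≢fj (sym fj≡wk))
                             (IsArc-prefix j+1≤s arc) (IsArc-reverse arc-w)
      closed : join (suc j) f h (suc k + suc j) ≡ join (suc j) f h 0
      closed = begin
        join (suc j) f h (suc k + suc j) ≡⟨ join-from (suc k) ⟩
        w (k ∸ k)                        ≡⟨ cong w (n∸n≡0 k) ⟩
        w 0                              ≡⟨ w0 ⟩
        f 0                              ≡⟨ join-< z<s ⟨
        join (suc j) f h 0               ∎
        where open ≡-Reasoning

    arc⇒geodesic : IsGeodesic Γ s f
    arc⇒geodesic = arc , (f , refl , refl , proj₁ arc) , shortest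
      where
      shortest : ∀ k → Walk Γ k (f 0) (f s) → s ≤ k
      shortest k walk with walk⇒arc walk
      ... | m , m≤k , arc-m = ≤-trans (noShortcut ≤-refl arc-m) m≤k

lemma4p1 : (Γ : Graph) (G : Permutation′ (Graph.n Γ) → Set) (s : ℕ) →
    Connected Γ → IsAutSubgroup Γ G → 2 ≤ s → GeodesicTransitive Γ G s →
    GirthAtLeast Γ (2 * s) → ArcTransitive Γ G s
lemma4p1 Γ G s _ _ 2≤s (_ , geodesicTransitive) girth with geodesicTransitive s (<⇒≤ 2≤s) ≤-refl
... | (f , arc-f , _) , transitive = (f , arc-f) , λ g h arc-g arc-h →
  transitive g h (arc⇒geodesic Γ girth arc-g) (arc⇒geodesic Γ girth arc-h)
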